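{- Let $z^*$ be the item requested in some step and let $y$ be an item with $z^*\prec y$ just before the request. Then, whichever move FPM performs, the state of the pair $\{z^*,y\}$ changes during the step as follows: $\alpha^d\to\alpha^d$; $\beta^d\to\alpha^d$; $\alpha^{oe}\to\alpha^d$; $\beta^o\to\alpha^d$; $\beta^{ne}\to$ $\alpha^d$ or $\alpha^{oe}$; $\gamma^{ne}\to$ one of $\beta^d,\beta^o,\beta^{ne}$.
   Context: List Update (uniform, partial cost model): accessing position $\ell$ costs $\ell-1$; adjacent swaps cost $1$. $a\prec b$ means $a$ is before $b$ in FPM's current list; $\preceq$ allows equality. For a pair $\{x,y\}$, $\sigma_{xy}$ is the subsequence of requests to $x$ or $y$; after each prefix of the input, $W^{xy}(xy)$ (resp. $W^{xy}(yx)$) is the minimum cost of serving the corresponding prefix of $\sigma_{xy}$ on a two-item list $\{x,y\}$ starting from their initial relative order and ending in configuration $xy$ (resp. $yx$). Mode of $\{x,y\}$ with $y\prec x$: $\alpha$ if $W^{xy}(yx)+1=W^{xy}(xy)$; $\beta$ if equal; $\gamma$ if $W^{xy}(yx)-1=W^{xy}(xy)$. FPM keeps targets $\theta_x$ (initially $\theta_x=x$). On a request to $z^*$: (1) every $y\neq z^*$ with $\theta_y=z^*$ gets $\theta_y:=$ successor of $z^*$; (2) partial move (insert $z^*$ immediately before $\theta_{z^*}$) or full move (move $z^*$ to front); (3) $\theta_{z^*}:=$ front item. Flavor of $\{x,y\}$ with $y\prec x$: $d$ if $\theta_y\preceq y\prec\theta_x\preceq x$; $o$ if $\theta_y\prec\theta_x\preceq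 y\prec x$; $e$ if $\theta_y=\theta_x\preceq y\prec x$; $n$ if $\theta_x\prec\theta_y\preceq y\prec x$. The state is $\xi^\omega$ (mode $\xi$, flavor $\omega$); $\alpha^{oe}$ means "$\alpha^o$ or $\alpha^e$", $\beta^{ne}$ means "$\beta^n$ or $\beta^e$", $\gamma^{ne}$ means "$\gamma^n$ or $\gamma^e$". -}

module Defs where

open import Data.Nat using (ℕ; zero; suc; _+_; _⊓_)
open import Data.Fin using (Fin; _≟_)
open import Data.List using (List; []; _∷_; _++_; foldl; map; [_]; head)
open import Data.List.Membership.Propositional using (_∈_)
open import Data.Maybe using (Maybe; just; nothing; fromMaybe)
open import Data.Bool using (Bool; true; false; if_then_else_)
open import Data.Product using (Σ; _×_; _,_; proj₁; proj₂)
open import Data.Sum using (_⊎_)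
open import Relation.Nullary using (yes; no)
open import Relation.Binary.PropositionalEquality using (_≡_)

module _ {n : ℕ} where

  Item : Set
  Item = Fin n

  _≺[_]_ : Item → List Item → Item → Set
  a ≺[ L ] b = Σ (List Item) λ p → Σ (List Item) λ q → (L ≡ p ++ (a ∷ q)) × (b ∈ q)

  _⪯[_]_ : Item → List Item → Item → Set
  a ⪯[ L ] b = (a ≡ b) ⊎ (a ≺[ L ] b)

  -- Work functions of a pair {a,b} (partial cost model, 2-item list).
  -- A pair of costs (W(ab) , W(ba)): W(ab) = cost ending in config "a before b".

  firstIs : Item → Item → List Item → Bool
  firstIs a b [] = false
  firstIs a b (x ∷ xs) with x ≟ a | x ≟ b
  ... | yes _ | _ = true
  ... | no _ | yes _ = false
  ... | no _ | no _ = firstIs a b xs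

  -- empty prefix: 0 in the initial relative order, 1 (one swap) otherwise
  W-init : List Item → Item → Item → ℕ × ℕ
  W-init L₀ a b = if firstIs a b L₀ then (0 , 1) else (1 , 0)

  -- serve request r (costs: position 1 ↦ 0, position 2 ↦ 1), then allow a swap (cost 1).
  -- Requests outside {a,b} are skipped (this realises the subsequence σ_ab).
  W-step : Item → Item → ℕ × ℕ → Item → ℕ × ℕ
  W-step a b (wab , wba) r with r ≟ a | r ≟ b
  ... | yes _ | _ = let sab = wab ; sba = suc wba in (sab ⊓ suc sba , sba ⊓ suc sab)
  ... | no _ | yes _ = let sab = suc wab ; sba = wba in (sab ⊓ suc sba , sba ⊓ suc sab)
  ... | no _ | no _ = (wab , wba)

  W : List Item → List Item → Item → Item → ℕ
  W L₀ σ a b = proj₁ (foldl (W-step a b) (W-init L₀ a b) σ)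

  -- Modes and flavors of a pair, written for front item f and back item b
  -- (f plays the role of y, b the role of x in the paper's definitions, y ≺ x).

  data Mode : Set where
    α β γ : Mode

  data Flavor : Set where
    d o e n' : Flavor

  HasMode : List Item → List Item → Item → Item → Mode → Set
  HasMode L₀ σ f b α = W L₀ σ f b + 1 ≡ W L₀ σ b f
  HasMode L₀ σ f b β = W L₀ σ f b ≡ W L₀ σ b f
  HasMode L₀ σ f b γ = W L₀ σ f b ≡ W L₀ σ b f + 1

  HasFlavor : List Item → (Item → Item) → Item → Item → Flavor → Set
  HasFlavor L θ f b d  = (θ f ⪯[ L ] f) × (f ≺[ L ] θ b) × (θ b ⪯[ L ] b)
  HasFlavor L θ f b o  = (θ f ≺[ L ] θ b) × (θ b ⪯[ L ] f) × (f ≺[ L ] b)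
  HasFlavor L θ f b e  = (θ f ≡ θ b) × (θ b ⪯[ L ] f) × (f ≺[ L ] b)
  HasFlavor L θ f b n' = (θ b ≺[ L ] θ f) × (θ f ⪯[ L ] f) × (f ≺[ L ] b)

  record Config : Set where
    constructor cfg
    field
      list   : List Item
      target : Item → Item
  open Config public

  data Move : Set where
    partial full : Move

  remove : Item → List Item → List Item
  remove z [] = []
  remove z (x ∷ xs) with x ≟ z
  ... | yes _ = xs
  ... | no _ = x ∷ remove z xs

  insertBefore : Item → Item → List Item → List Item
  insertBefore t z [] = z ∷ []
  insertBefore t z (x ∷ xs) with x ≟ t
  ... | yes _ = z ∷ x ∷ xs
  ... | no _ = x ∷ insertBefore t z xs

  succOf : Item → List Item → Maybe Item
  succOf z [] = nothing
  succOf z (x ∷ xs) with x ≟ z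
  ... | yes _ = head xs
  ... | no _ = succOf z xs

  headOr : Item → List Item → Item
  headOr dflt [] = dflt
  headOr dflt (x ∷ _) = x

  retarget : Item → List Item → (Item → Item) → Item → Item
  retarget z L θ y with y ≟ z | θ y ≟ z
  ... | yes _ | _ = θ y
  ... | no _ | yes _ = fromMaybe (θ y) (succOf z L)
  ... | no _ | no _ = θ y

  doMove : Move → Item → Item → List Item → List Item
  doMove full z t L = z ∷ remove z L
  doMove partial z t L with t ≟ z
  ... | yes _ = L
  ... | no _ = insertBefore t z (remove z L)

  setTarget : Item → Item → (Item → Item) → Item → Item
  setTarget z v θ y with y ≟ z
  ... | yes _ = v
  ... | no _ = θ y

  step : Config → Item → Move → Config
  step (cfg L θ) z m =
    let θ₁ = retarget z L θ
        L' = doMove m z (θ₁ z) L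
    in cfg L' (setTarget z (headOr z L') θ₁)

  initCfg : List Item → Config
  initCfg L₀ = cfg L₀ (λ x → x)

  run : List Item → List (Item × Move) → Config
  run L₀ h = foldl (λ c rm → step c (proj₁ rm) (proj₂ rm)) (initCfg L₀) h

  requests : List (Item × Move) → List Item
  requests h = map proj₁ h

  InState : List Item → List Item → Config → Item → Item → Mode → Flavor → Set
  InState L₀ σ c f b m w = HasMode L₀ σ f b m × HasFlavor (list c) (target c) f b w

{-# OPTIONS --safe #-}
module Submission where

-- A request to z, the front item of the pair, costs 0 in configuration zy and 1 in yz, and a
-- swap costs 1, so (W(zy), W(yz)) becomes (W(zy) ⊓ (W(yz) + 2), (W(yz) + 1) ⊓ (W(zy) + 1)); this
-- sends the modes α and β to α, and γ to β.
-- FPM only permutes the list: it moves z to just before θ_z (which is weakly before z in every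
-- flavor) or to the front, and keeps the relative order of all other items.  Hence z stays
-- before y, θ_z becomes the front item, and θ_y, which step (1) may advance from z to z's
-- successor, stays weakly before y; this leaves only the flavors d, o, e.  When θ_z ⪯ θ_y
-- beforehand, as in the flavors d, o, e, z lands before θ_y and the new flavor is d.

open import Defs
open import Data.Bool using (true; false; not)
open import Data.Fin using (Fin; _≟_)
open import Data.List using (List; []; _∷_; _++_; [_]; foldl)
open import Data.List.Properties using (foldl-∷ʳ)
open import Data.List.Membership.Propositional using (_∈_)
open import Data.List.Relation.Binary.Permutation.Propositional
  using (_↭_; ↭-refl; ↭-prep; ↭-swap; ↭-sym; ↭-trans; ↭⇒↭ₛ)
open import Data.List.Relation.Binary.Permutation.Propositional.Properties using (∈-resp-↭)
import Data.List.Relation.Binary.Permutation.Setoid.Properties as Permutationₛ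
open import Data.List.Relation.Unary.Any using (here; there)
open import Data.List.Relation.Unary.Unique.Propositional using (Unique; tail)
open import Data.List.Relation.Unary.Unique.Propositional.Properties using (Unique[x∷xs]⇒x∉xs)
open import Data.Maybe using (just)
open import Data.Nat using (ℕ; zero; suc; _+_; _⊓_)
open import Data.Product using (Σ-syntax; _×_; _,_; proj₁; proj₂; swap)
import Data.Product as Product
open import Data.Sum using (_⊎_; inj₁; inj₂)
import Data.Sum as Sum
open import Data.Empty using (⊥-elim)
open import Function using (id; _∘_)
open import Relation.Nullary using (¬_; yes; no)
open import Relation.Binary.PropositionalEquality
  using (_≡_; _≢_; refl; sym; trans; cong; subst; ≢-sym; setoid)

module _ {n : ℕ} where

  private
    variable
      a b f t w x y z : Fin n
      xs L L₀ : List (Fin n)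
      θ : Fin n → Fin n
      σ : List (Fin n)

  infix 4 _≺ᵢ[_]_ _⪯ᵢ[_]_

  data _≺ᵢ[_]_ (a : Fin n) : List (Fin n) → Fin n → Set where
    ≺-head : b ∈ xs → a ≺ᵢ[ a ∷ xs ] b
    ≺-tail : a ≺ᵢ[ xs ] b → a ≺ᵢ[ x ∷ xs ] b

  _⪯ᵢ[_]_ : Fin n → List (Fin n) → Fin n → Set
  a ⪯ᵢ[ L ] b = a ≡ b ⊎ a ≺ᵢ[ L ] b

  ≺⇒≺ᵢ : a ≺[ L ] b → a ≺ᵢ[ L ] b
  ≺⇒≺ᵢ ([] , _ , refl , b∈q) = ≺-head b∈q
  ≺⇒≺ᵢ (_ ∷ p , q , refl , b∈q) = ≺-tail (≺⇒≺ᵢ (p , q , refl , b∈q))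

  ≺ᵢ⇒≺ : a ≺ᵢ[ L ] b → a ≺[ L ] b
  ≺ᵢ⇒≺ (≺-head {xs = xs} b∈xs) = [] , xs , refl , b∈xs
  ≺ᵢ⇒≺ (≺-tail {x = x} a≺b) with ≺ᵢ⇒≺ a≺b
  ... | p , q , refl , b∈q = x ∷ p , q , refl , b∈q

  ⪯⇒⪯ᵢ : a ⪯[ L ] b → a ⪯ᵢ[ L ] b
  ⪯⇒⪯ᵢ = Sum.map₂ ≺⇒≺ᵢ

  ⪯ᵢ⇒⪯ : a ⪯ᵢ[ L ] b → a ⪯[ L ] b
  ⪯ᵢ⇒⪯ = Sum.map₂ ≺ᵢ⇒≺

  ≺ᵢ-∈ˡ : a ≺ᵢ[ L ] b → a ∈ L
  ≺ᵢ-∈ˡ (≺-head _) = here refl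
  ≺ᵢ-∈ˡ (≺-tail a≺b) = there (≺ᵢ-∈ˡ a≺b)

  ≺ᵢ-∈ʳ : a ≺ᵢ[ L ] b → b ∈ L
  ≺ᵢ-∈ʳ (≺-head b∈xs) = there b∈xs
  ≺ᵢ-∈ʳ (≺-tail a≺b) = there (≺ᵢ-∈ʳ a≺b)

  ⪯ᵢ-∈ˡ : b ∈ L → a ⪯ᵢ[ L ] b → a ∈ L
  ⪯ᵢ-∈ˡ b∈L (inj₁ refl) = b∈L
  ⪯ᵢ-∈ˡ _ (inj₂ a≺b) = ≺ᵢ-∈ˡ a≺b

  ⪯ᵢ-tail : a ⪯ᵢ[ xs ] b → a ⪯ᵢ[ x ∷ xs ] b
  ⪯ᵢ-tail = Sum.map₂ ≺-tail

  ⪯ᵢ∧≢⇒≺ᵢ : a ⪯ᵢ[ L ] b → a ≢ b → a ≺ᵢ[ L ] b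
  ⪯ᵢ∧≢⇒≺ᵢ (inj₁ a≡b) a≢b = ⊥-elim (a≢b a≡b)
  ⪯ᵢ∧≢⇒≺ᵢ (inj₂ a≺b) _ = a≺b

  ≺ᵢ-irrefl : Unique L → ¬ a ≺ᵢ[ L ] a
  ≺ᵢ-irrefl u (≺-head a∈xs) = Unique[x∷xs]⇒x∉xs u a∈xs
  ≺ᵢ-irrefl u (≺-tail a≺a) = ≺ᵢ-irrefl (tail u) a≺a

  ≺ᵢ⇒≢ : Unique L → a ≺ᵢ[ L ] b → a ≢ b
  ≺ᵢ⇒≢ u a≺a refl = ≺ᵢ-irrefl u a≺a

  ≺ᵢ-trans : Unique L → a ≺ᵢ[ L ] b → b ≺ᵢ[ L ] w → a ≺ᵢ[ L ] w
  ≺ᵢ-trans u (≺-head b∈xs) (≺-head _) = ⊥-elim (Unique[x∷xs]⇒x∉xs u b∈xs)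
  ≺ᵢ-trans u (≺-head _) (≺-tail b≺w) = ≺-head (≺ᵢ-∈ʳ b≺w)
  ≺ᵢ-trans u (≺-tail a≺b) (≺-head _) = ⊥-elim (Unique[x∷xs]⇒x∉xs u (≺ᵢ-∈ʳ a≺b))
  ≺ᵢ-trans u (≺-tail a≺b) (≺-tail b≺w) = ≺-tail (≺ᵢ-trans (tail u) a≺b b≺w)

  ⪯ᵢ-≺ᵢ-trans : Unique L → a ⪯ᵢ[ L ] b → b ≺ᵢ[ L ] w → a ≺ᵢ[ L ] w
  ⪯ᵢ-≺ᵢ-trans u (inj₁ refl) b≺w = b≺w
  ⪯ᵢ-≺ᵢ-trans u (inj₂ a≺b) b≺w = ≺ᵢ-trans u a≺b b≺w

  ≺ᵢ-⪯ᵢ-trans : Unique L → a ≺ᵢ[ L ] b → b ⪯ᵢ[ L ] w → a ≺ᵢ[ L ] w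
  ≺ᵢ-⪯ᵢ-trans u a≺b (inj₁ refl) = a≺b
  ≺ᵢ-⪯ᵢ-trans u a≺b (inj₂ b≺w) = ≺ᵢ-trans u a≺b b≺w

  ≺ᵢ-total : a ∈ L → b ∈ L → a ≺ᵢ[ L ] b ⊎ b ⪯ᵢ[ L ] a
  ≺ᵢ-total (here refl) (here refl) = inj₂ (inj₁ refl)
  ≺ᵢ-total (here refl) (there b∈xs) = inj₁ (≺-head b∈xs)
  ≺ᵢ-total (there a∈xs) (here refl) = inj₂ (inj₂ (≺-head a∈xs))
  ≺ᵢ-total (there a∈xs) (there b∈xs) = Sum.map ≺-tail ⪯ᵢ-tail (≺ᵢ-total a∈xs b∈xs)

  headOr-⪯ᵢ : w ∈ L → headOr a L ⪯ᵢ[ L ] w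
  headOr-⪯ᵢ (here refl) = inj₁ refl
  headOr-⪯ᵢ (there w∈xs) = inj₂ (≺-head w∈xs)

  ∈-remove⁺ : w ≢ z → w ∈ L → w ∈ remove z L
  ∈-remove⁺ {z = z} {L = x ∷ _} _ _ with x ≟ z
  ∈-remove⁺ w≢z (here refl) | yes refl = ⊥-elim (w≢z refl)
  ∈-remove⁺ _ (there w∈xs) | yes _ = w∈xs
  ∈-remove⁺ _ (here w≡x) | no _ = here w≡x
  ∈-remove⁺ w≢z (there w∈xs) | no _ = there (∈-remove⁺ w≢z w∈xs)

  ≺ᵢ-remove⁺ : a ≢ z → b ≢ z → a ≺ᵢ[ L ] b → a ≺ᵢ[ remove z L ] b
  ≺ᵢ-remove⁺ {a = a} {z = z} a≢z b≢z (≺-head b∈xs) with a ≟ z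
  ... | yes a≡z = ⊥-elim (a≢z a≡z)
  ... | no _ = ≺-head (∈-remove⁺ b≢z b∈xs)
  ≺ᵢ-remove⁺ {z = z} a≢z b≢z (≺-tail {x = x} a≺b) with x ≟ z
  ... | yes _ = a≺b
  ... | no _ = ≺-tail (≺ᵢ-remove⁺ a≢z b≢z a≺b)

  ⪯ᵢ-remove⁺ : a ≢ z → b ≢ z → a ⪯ᵢ[ L ] b → a ⪯ᵢ[ remove z L ] b
  ⪯ᵢ-remove⁺ a≢z b≢z = Sum.map₂ (≺ᵢ-remove⁺ a≢z b≢z)

  remove-↭ : z ∈ L → z ∷ remove z L ↭ L
  remove-↭ {z = z} {L = x ∷ _} _ with x ≟ z
  remove-↭ _ | yes refl = ↭-refl
  remove-↭ (here refl) | no x≢z = ⊥-elim (x≢z refl)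
  remove-↭ {z = z} {L = x ∷ _} (there z∈xs) | no _ =
    ↭-trans (↭-swap z x ↭-refl) (↭-prep x (remove-↭ z∈xs))

  ∈-insertBefore⁺ : w ∈ L → w ∈ insertBefore t z L
  ∈-insertBefore⁺ {L = x ∷ _} {t = t} w∈L with x ≟ t
  ... | yes _ = there w∈L
  ∈-insertBefore⁺ (here w≡x) | no _ = here w≡x
  ∈-insertBefore⁺ (there w∈xs) | no _ = there (∈-insertBefore⁺ w∈xs)

  ≺ᵢ-insertBefore⁺ : a ≺ᵢ[ L ] b → a ≺ᵢ[ insertBefore t z L ] b
  ≺ᵢ-insertBefore⁺ {a = a} {t = t} a≺b@(≺-head b∈xs) with a ≟ t
  ... | yes _ = ≺-tail a≺b
  ... | no _ = ≺-head (∈-insertBefore⁺ b∈xs)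
  ≺ᵢ-insertBefore⁺ {t = t} (≺-tail {x = x} a≺b) with x ≟ t
  ... | yes _ = ≺-tail (≺-tail a≺b)
  ... | no _ = ≺-tail (≺ᵢ-insertBefore⁺ a≺b)

  insertBefore-≺ᵢ : t ⪯ᵢ[ L ] w → w ∈ L → z ≺ᵢ[ insertBefore t z L ] w
  insertBefore-≺ᵢ {t = t} {L = x ∷ _} _ w∈L with x ≟ t
  ... | yes _ = ≺-head w∈L
  insertBefore-≺ᵢ (inj₁ refl) (here refl) | no x≢t = ⊥-elim (x≢t refl)
  insertBefore-≺ᵢ (inj₁ refl) (there w∈xs) | no _ = ≺-tail (insertBefore-≺ᵢ (inj₁ refl) w∈xs)
  insertBefore-≺ᵢ (inj₂ (≺-head _)) _ | no x≢t = ⊥-elim (x≢t refl)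
  insertBefore-≺ᵢ (inj₂ (≺-tail t≺w)) _ | no _ = ≺-tail (insertBefore-≺ᵢ (inj₂ t≺w) (≺ᵢ-∈ʳ t≺w))

  insertBefore-↭ : insertBefore t z L ↭ z ∷ L
  insertBefore-↭ {L = []} = ↭-refl
  insertBefore-↭ {t = t} {z = z} {L = x ∷ _} with x ≟ t
  ... | yes _ = ↭-refl
  ... | no _ = ↭-trans (↭-prep x insertBefore-↭) (↭-swap x z ↭-refl)

  doMove-≺ᵢ : ∀ m → t ⪯ᵢ[ L ] w → w ∈ L → w ≢ z → z ≺ᵢ[ doMove m z t L ] w
  doMove-≺ᵢ full _ w∈L w≢z = ≺-head (∈-remove⁺ w≢z w∈L)
  doMove-≺ᵢ {t = t} {z = z} partial t⪯w w∈L w≢z with t ≟ z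
  ... | yes refl = ⪯ᵢ∧≢⇒≺ᵢ t⪯w (≢-sym w≢z)
  ... | no t≢z = insertBefore-≺ᵢ (⪯ᵢ-remove⁺ t≢z w≢z t⪯w) (∈-remove⁺ w≢z w∈L)

  ≺ᵢ-doMove⁺ : ∀ m → a ≢ z → b ≢ z → a ≺ᵢ[ L ] b → a ≺ᵢ[ doMove m z t L ] b
  ≺ᵢ-doMove⁺ full a≢z b≢z a≺b = ≺-tail (≺ᵢ-remove⁺ a≢z b≢z a≺b)
  ≺ᵢ-doMove⁺ {z = z} {t = t} partial a≢z b≢z a≺b with t ≟ z
  ... | yes _ = a≺b
  ... | no _ = ≺ᵢ-insertBefore⁺ (≺ᵢ-remove⁺ a≢z b≢z a≺b)

  ⪯ᵢ-doMove⁺ : ∀ m → a ≢ z → b ≢ z → a ⪯ᵢ[ L ] b → a ⪯ᵢ[ doMove m z t L ] b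
  ⪯ᵢ-doMove⁺ m a≢z b≢z = Sum.map₂ (≺ᵢ-doMove⁺ m a≢z b≢z)

  doMove-↭ : ∀ m → z ∈ L → doMove m z t L ↭ L
  doMove-↭ full z∈L = remove-↭ z∈L
  doMove-↭ {z = z} {t = t} partial z∈L with t ≟ z
  ... | yes _ = ↭-refl
  ... | no _ = ↭-trans insertBefore-↭ (remove-↭ z∈L)

  runFrom : Config → List (Fin n × Move) → Config
  runFrom = foldl (λ c rm → step c (proj₁ rm) (proj₂ rm))

  runFrom-↭ : (∀ i → i ∈ L₀) → ∀ c h → list c ↭ L₀ → list (runFrom c h) ↭ L₀
  runFrom-↭ complete c [] c↭L₀ = c↭L₀
  runFrom-↭ {L₀ = L₀} complete c ((z , m) ∷ h) c↭L₀ = runFrom-↭ complete (step c z m) h step↭L₀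
    where
    step↭L₀ : list (step c z m) ↭ L₀
    step↭L₀ = ↭-trans (doMove-↭ m (∈-resp-↭ (↭-sym c↭L₀) (complete z))) c↭L₀

  run-↭ : (∀ i → i ∈ L₀) → ∀ h → L₀ ↭ list (run L₀ h)
  run-↭ {L₀ = L₀} complete h = ↭-sym (runFrom-↭ complete (initCfg L₀) h ↭-refl)

  run-unique : Unique L₀ → (∀ i → i ∈ L₀) → ∀ h → Unique (list (run L₀ h))
  run-unique u complete h = Permutationₛ.Unique-resp-↭ (setoid (Fin n)) (↭⇒↭ₛ (run-↭ complete h)) u

  run-complete : (∀ i → i ∈ L₀) → ∀ h i → i ∈ list (run L₀ h)
  run-complete complete h i = ∈-resp-↭ (run-↭ complete h) (complete i)

  succOf-≺ᵢ : Unique L → z ≺ᵢ[ L ] y →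
    Σ[ s ∈ Fin n ] succOf z L ≡ just s × z ≺ᵢ[ L ] s × s ⪯ᵢ[ L ] y
  succOf-≺ᵢ {z = z} _ (≺-head {xs = s ∷ _} y∈xs) with z ≟ z
  ... | yes _ = s , refl , ≺-head (here refl) , ⪯ᵢ-tail (headOr-⪯ᵢ {a = z} y∈xs)
  ... | no z≢z = ⊥-elim (z≢z refl)
  succOf-≺ᵢ {z = z} u (≺-tail {x = x} z≺y) with x ≟ z
  ... | yes refl = ⊥-elim (Unique[x∷xs]⇒x∉xs u (≺ᵢ-∈ˡ z≺y))
  ... | no _ = Product.map₂ (Product.map₂ (Product.map ≺-tail ⪯ᵢ-tail)) (succOf-≺ᵢ (tail u) z≺y)

  retarget-self : retarget z L θ z ≡ θ z
  retarget-self {z = z} with z ≟ z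
  ... | yes _ = refl
  ... | no z≢z = ⊥-elim (z≢z refl)

  retarget-cases : Unique L → z ≺ᵢ[ L ] y →
    (θ y ≢ z × retarget z L θ y ≡ θ y) ⊎ (z ≺ᵢ[ L ] retarget z L θ y × retarget z L θ y ⪯ᵢ[ L ] y)
  retarget-cases {z = z} {y = y} {θ = θ} u z≺y with y ≟ z | θ y ≟ z
  ... | yes refl | _ = ⊥-elim (≺ᵢ-irrefl u z≺y)
  ... | no _ | no θy≢z = inj₁ (θy≢z , refl)
  ... | no _ | yes _ with succOf-≺ᵢ u z≺y
  ...   | s , succ≡s , z≺s , s⪯y rewrite succ≡s = inj₂ (z≺s , s⪯y)

  setTarget-self : setTarget z a θ z ≡ a
  setTarget-self {z = z} with z ≟ z
  ... | yes _ = refl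
  ... | no z≢z = ⊥-elim (z≢z refl)

  setTarget-other : y ≢ z → setTarget z a θ y ≡ θ y
  setTarget-other {y = y} {z = z} y≢z with y ≟ z
  ... | yes y≡z = ⊥-elim (y≢z y≡z)
  ... | no _ = refl

  front-target-⪯ᵢ : Unique L → ∀ w → HasFlavor L θ f b w → θ f ⪯ᵢ[ L ] f
  front-target-⪯ᵢ u d (θf⪯f , _ , _) = ⪯⇒⪯ᵢ θf⪯f
  front-target-⪯ᵢ u o (θf≺θb , θb⪯f , _) = inj₂ (≺ᵢ-⪯ᵢ-trans u (≺⇒≺ᵢ θf≺θb) (⪯⇒⪯ᵢ θb⪯f))
  front-target-⪯ᵢ u e (θf≡θb , θb⪯f , _) = subst (_⪯ᵢ[ _ ] _) (sym θf≡θb) (⪯⇒⪯ᵢ θb⪯f)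
  front-target-⪯ᵢ u n' (_ , θf⪯f , _) = ⪯⇒⪯ᵢ θf⪯f

  back-target-⪯ᵢ : Unique L → ∀ w → HasFlavor L θ f b w → θ b ⪯ᵢ[ L ] b
  back-target-⪯ᵢ u d (_ , _ , θb⪯b) = ⪯⇒⪯ᵢ θb⪯b
  back-target-⪯ᵢ u o (_ , θb⪯f , f≺b) = inj₂ (⪯ᵢ-≺ᵢ-trans u (⪯⇒⪯ᵢ θb⪯f) (≺⇒≺ᵢ f≺b))
  back-target-⪯ᵢ u e (_ , θb⪯f , f≺b) = inj₂ (⪯ᵢ-≺ᵢ-trans u (⪯⇒⪯ᵢ θb⪯f) (≺⇒≺ᵢ f≺b))
  back-target-⪯ᵢ u n' (θb≺θf , θf⪯f , f≺b) =
    inj₂ (≺ᵢ-trans u (≺ᵢ-⪯ᵢ-trans u (≺⇒≺ᵢ θb≺θf) (⪯⇒⪯ᵢ θf⪯f)) (≺⇒≺ᵢ f≺b))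

  targets-⪯ᵢ : Unique L → ∀ w → w ≢ n' → HasFlavor L θ f b w → θ f ⪯ᵢ[ L ] θ b
  targets-⪯ᵢ u d _ (θf⪯f , f≺θb , _) = inj₂ (⪯ᵢ-≺ᵢ-trans u (⪯⇒⪯ᵢ θf⪯f) (≺⇒≺ᵢ f≺θb))
  targets-⪯ᵢ u o _ (θf≺θb , _ , _) = inj₂ (≺⇒≺ᵢ θf≺θb)
  targets-⪯ᵢ u e _ (θf≡θb , _ , _) = inj₁ θf≡θb
  targets-⪯ᵢ u n' w≢n' _ = ⊥-elim (w≢n' refl)

  flavor-d-of-headTarget : θ f ≡ headOr f L → f ≺ᵢ[ L ] θ b → θ b ⪯ᵢ[ L ] b → HasFlavor L θ f b d
  flavor-d-of-headTarget {f = f} θf≡head f≺θb θb⪯b =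
    ⪯ᵢ⇒⪯ (subst (_⪯ᵢ[ _ ] f) (sym θf≡head) (headOr-⪯ᵢ (≺ᵢ-∈ˡ f≺θb))) , ≺ᵢ⇒≺ f≺θb , ⪯ᵢ⇒⪯ θb⪯b

  flavor-of-headTarget : θ f ≡ headOr f L → f ≺ᵢ[ L ] b → θ b ⪯ᵢ[ L ] b →
    HasFlavor L θ f b d ⊎ (HasFlavor L θ f b o ⊎ HasFlavor L θ f b e)
  flavor-of-headTarget {θ = θ} {f = f} {L = L} {b = b} θf≡head f≺b θb⪯b
    with ≺ᵢ-total (≺ᵢ-∈ˡ f≺b) θb∈L | headOr-⪯ᵢ {a = f} θb∈L
    where
    θb∈L : θ b ∈ L
    θb∈L = ⪯ᵢ-∈ˡ (≺ᵢ-∈ʳ f≺b) θb⪯b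
  ... | inj₁ f≺θb | _ = inj₁ (flavor-d-of-headTarget θf≡head f≺θb θb⪯b)
  ... | inj₂ θb⪯f | inj₁ head≡θb = inj₂ (inj₂ (trans θf≡head head≡θb , ⪯ᵢ⇒⪯ θb⪯f , ≺ᵢ⇒≺ f≺b))
  ... | inj₂ θb⪯f | inj₂ head≺θb =
    inj₂ (inj₁ (≺ᵢ⇒≺ (subst (_≺ᵢ[ L ] θ b) (sym θf≡head) head≺θb) , ⪯ᵢ⇒⪯ θb⪯f , ≺ᵢ⇒≺ f≺b))

  module FrontRequest {L : List (Fin n)} {θ : Fin n → Fin n} (u : Unique L) (complete : ∀ i → i ∈ L)
                      {z y : Fin n} (z≺y : z ≺ᵢ[ L ] y) (m : Move {n}) where

    private
      θ₁ θ′ : Fin n → Fin n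
      θ₁ = retarget z L θ
      θ′ = target (step (cfg L θ) z m)
      L′ : List (Fin n)
      L′ = list (step (cfg L θ) z m)

    y≢z : y ≢ z
    y≢z = ≢-sym (≺ᵢ⇒≢ u z≺y)

    moves-before : θ z ⪯ᵢ[ L ] w → w ≢ z → z ≺ᵢ[ L′ ] w
    moves-before {w = w} θz⪯w =
      doMove-≺ᵢ m (subst (_⪯ᵢ[ L ] w) (sym (retarget-self {θ = θ})) θz⪯w) (complete w)

    θ₁y≢z : θ₁ y ≢ z
    θ₁y≢z with retarget-cases {θ = θ} u z≺y
    ... | inj₁ (θy≢z , θ₁y≡θy) = subst (_≢ z) (sym θ₁y≡θy) θy≢z
    ... | inj₂ (z≺θ₁y , _) = ≢-sym (≺ᵢ⇒≢ u z≺θ₁y)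

    back-target-after : θ y ⪯ᵢ[ L ] y → θ′ y ⪯ᵢ[ L′ ] y
    back-target-after θy⪯y =
      subst (_⪯ᵢ[ L′ ] y) (sym (setTarget-other y≢z)) (⪯ᵢ-doMove⁺ m θ₁y≢z y≢z θ₁y⪯y)
      where
      θ₁y⪯y : θ₁ y ⪯ᵢ[ L ] y
      θ₁y⪯y with retarget-cases {θ = θ} u z≺y
      ... | inj₁ (_ , θ₁y≡θy) = subst (_⪯ᵢ[ L ] y) (sym θ₁y≡θy) θy⪯y
      ... | inj₂ (_ , θ₁y⪯y) = θ₁y⪯y

    front-before-back-target : θ z ⪯ᵢ[ L ] z → θ z ⪯ᵢ[ L ] θ y → z ≺ᵢ[ L′ ] θ′ y
    front-before-back-target θz⪯z θz⪯θy =
      subst (z ≺ᵢ[ L′ ]_) (sym (setTarget-other y≢z)) (moves-before θz⪯θ₁y θ₁y≢z)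
      where
      θz⪯θ₁y : θ z ⪯ᵢ[ L ] θ₁ y
      θz⪯θ₁y with retarget-cases {θ = θ} u z≺y
      ... | inj₁ (_ , θ₁y≡θy) = subst (θ z ⪯ᵢ[ L ]_) (sym θ₁y≡θy) θz⪯θy
      ... | inj₂ (z≺θ₁y , _) = inj₂ (⪯ᵢ-≺ᵢ-trans u θz⪯z z≺θ₁y)

    flavor-d-after : ∀ w → w ≢ n' → HasFlavor L θ z y w → HasFlavor L′ θ′ z y d
    flavor-d-after w w≢n' φ =
      flavor-d-of-headTarget (setTarget-self {z = z} {θ = θ₁})
        (front-before-back-target (front-target-⪯ᵢ u w φ) (targets-⪯ᵢ u w w≢n' φ))
        (back-target-after (back-target-⪯ᵢ u w φ))

    flavor-after : ∀ w → HasFlavor L θ z y w →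
      HasFlavor L′ θ′ z y d ⊎ (HasFlavor L′ θ′ z y o ⊎ HasFlavor L′ θ′ z y e)
    flavor-after w φ =
      flavor-of-headTarget (setTarget-self {z = z} {θ = θ₁})
        (moves-before (inj₂ (⪯ᵢ-≺ᵢ-trans u (front-target-⪯ᵢ u w φ) z≺y)) y≢z)
        (back-target-after (back-target-⪯ᵢ u w φ))

  works : List (Fin n) → List (Fin n) → Fin n → Fin n → ℕ × ℕ
  works L₀ σ a b = foldl (W-step a b) (W-init L₀ a b) σ

  firstIs-swap : a ∈ L → a ≢ b → firstIs b a L ≡ not (firstIs a b L)
  firstIs-swap {a = a} {L = x ∷ _} {b = b} a∈L a≢b with x ≟ a | x ≟ b
  ... | yes refl | yes refl = ⊥-elim (a≢b refl)
  ... | yes _ | no _ = refl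
  ... | no _ | yes _ = refl
  firstIs-swap (here refl) _ | no x≢a | no _ = ⊥-elim (x≢a refl)
  firstIs-swap (there a∈xs) a≢b | no _ | no _ = firstIs-swap a∈xs a≢b

  W-init-swap : a ∈ L → a ≢ b → W-init L b a ≡ swap (W-init L a b)
  W-init-swap {a = a} {L = L} {b = b} a∈L a≢b rewrite firstIs-swap a∈L a≢b with firstIs a b L
  ... | true = refl
  ... | false = refl

  W-step-swap : a ≢ b → ∀ p x → W-step b a (swap p) x ≡ swap (W-step a b p x)
  W-step-swap {a = a} {b = b} a≢b _ x with x ≟ a | x ≟ b
  ... | yes refl | yes refl = ⊥-elim (a≢b refl)
  ... | yes _ | no _ = refl
  ... | no _ | yes _ = refl
  ... | no _ | no _ = refl

  foldl-W-step-swap : a ≢ b → ∀ σ p → foldl (W-step b a) (swap p) σ ≡ swap (foldl (W-step a b) p σ)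
  foldl-W-step-swap a≢b [] p = refl
  foldl-W-step-swap {a = a} {b = b} a≢b (x ∷ σ) p =
    trans (cong (λ q → foldl (W-step b a) q σ) (W-step-swap a≢b p x))
          (foldl-W-step-swap a≢b σ (W-step a b p x))

  works-swap : a ∈ L₀ → a ≢ b → works L₀ σ b a ≡ swap (works L₀ σ a b)
  works-swap {a = a} {L₀ = L₀} {b = b} {σ = σ} a∈L₀ a≢b =
    trans (cong (λ p → foldl (W-step b a) p σ) (W-init-swap a∈L₀ a≢b)) (foldl-W-step-swap a≢b σ _)

  ModeOf : ℕ × ℕ → Mode {n} → Set
  ModeOf (u , v) α = u + 1 ≡ v
  ModeOf (u , v) β = u ≡ v
  ModeOf (u , v) γ = u ≡ v + 1

  HasMode≡ModeOf : ∀ m → HasMode L₀ σ f b m ≡ ModeOf (W L₀ σ f b , W L₀ σ b f) m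
  HasMode≡ModeOf α = refl
  HasMode≡ModeOf β = refl
  HasMode≡ModeOf γ = refl

  HasMode≡ModeOf-works : a ∈ L₀ → a ≢ b → ∀ m → HasMode L₀ σ a b m ≡ ModeOf (works L₀ σ a b) m
  HasMode≡ModeOf-works {a = a} {L₀ = L₀} {b = b} {σ = σ} a∈L₀ a≢b m =
    trans (HasMode≡ModeOf m)
          (cong (λ v → ModeOf (W L₀ σ a b , v) m) (cong proj₁ (works-swap {σ = σ} a∈L₀ a≢b)))

  requestFirst : ℕ × ℕ → ℕ × ℕ
  requestFirst (u , v) = u ⊓ suc (suc v) , suc v ⊓ suc u

  W-step-first : ∀ p → W-step a b p a ≡ requestFirst p
  W-step-first {a = a} _ with a ≟ a
  ... | yes _ = refl
  ... | no a≢a = ⊥-elim (a≢a refl)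

  works-requestFirst : ∀ σ → works L₀ (σ ++ [ a ]) a b ≡ requestFirst (works L₀ σ a b)
  works-requestFirst {L₀ = L₀} {a = a} {b = b} σ =
    trans (foldl-∷ʳ (W-step a b) (W-init L₀ a b) a σ) (W-step-first (works L₀ σ a b))

  modeAfterRequestFirst : Mode {n} → Mode {n}
  modeAfterRequestFirst α = α
  modeAfterRequestFirst β = α
  modeAfterRequestFirst γ = β

  ModeOf-requestFirst : ∀ m {p} → ModeOf p m → ModeOf (requestFirst p) (modeAfterRequestFirst m)
  ModeOf-requestFirst α {zero , _} refl = refl
  ModeOf-requestFirst α {suc u , _} refl = cong suc (ModeOf-requestFirst α {u , _} refl)
  ModeOf-requestFirst β {zero , _} refl = refl
  ModeOf-requestFirst β {suc u , _} refl = cong suc (ModeOf-requestFirst β {u , _} refl)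
  ModeOf-requestFirst γ {_ , zero} refl = refl
  ModeOf-requestFirst γ {_ , suc v} refl = cong suc (ModeOf-requestFirst γ {_ , v} refl)

  HasMode-requestFirst : a ∈ L₀ → a ≢ b → ∀ m →
    HasMode L₀ σ a b m → HasMode L₀ (σ ++ [ a ]) a b (modeAfterRequestFirst m)
  HasMode-requestFirst {a = a} {L₀ = L₀} {b = b} {σ = σ} a∈L₀ a≢b m hasMode =
    subst id (sym modeAfter) (ModeOf-requestFirst m modeBefore)
    where
    modeBefore : ModeOf (works L₀ σ a b) m
    modeBefore = subst id (HasMode≡ModeOf-works a∈L₀ a≢b m) hasMode
    m′ : Mode
    m′ = modeAfterRequestFirst m
    modeAfter : HasMode L₀ (σ ++ [ a ]) a b m′ ≡ ModeOf (requestFirst (works L₀ σ a b)) m′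
    modeAfter = trans (HasMode≡ModeOf-works a∈L₀ a≢b m′)
                      (cong (λ p → ModeOf p m′) (works-requestFirst {L₀ = L₀} σ))

lemma4p5 : (n : ℕ) (L₀ : List (Fin n)) → Unique L₀ → (∀ i → i ∈ L₀) →
    (h : List (Fin n × Move)) (z y : Fin n) (mv : Move) →
    z ≺[ list (run L₀ h) ] y →
    let c  = run L₀ h
        c' = step c z mv
        σ  = requests h
        σ' = requests h ++ [ z ]
        Before = λ m w → InState L₀ σ c z y m w
        After  = λ m w → InState L₀ σ' c' z y m w
    in (Before α d → After α d)
     × (Before β d → After α d)
     × (Before α o ⊎ Before α e → After α d)
     × (Before β o → After α d)
     × (Before β n' ⊎ Before β e → After α d ⊎ (After α o ⊎ After α e))
     × (Before γ n' ⊎ Before γ e → After β d ⊎ (After β o ⊎ (After β n' ⊎ After β e)))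
lemma4p5 n L₀ unique complete h z y mv z≺y =
    stepTo-d α d (λ ())
  , stepTo-d β d (λ ())
  , Sum.[ stepTo-d α o (λ ()) , stepTo-d α e (λ ()) ]
  , stepTo-d β o (λ ())
  , Sum.[ stepTo-doe β n' , inj₁ ∘ stepTo-d β e (λ ()) ]
  , Sum.[ Sum.map₂ (Sum.map₂ inj₂) ∘ stepTo-doe γ n' , inj₁ ∘ stepTo-d γ e (λ ()) ]
  where
  u : Unique (list (run L₀ h))
  u = run-unique unique complete h

  z≺ᵢy : z ≺ᵢ[ list (run L₀ h) ] y
  z≺ᵢy = ≺⇒≺ᵢ z≺y

  open FrontRequest u (run-complete complete h) z≺ᵢy mv

  State State′ : Mode → Flavor → Set
  State = InState L₀ (requests h) (run L₀ h) z y
  State′ = InState L₀ (requests h ++ [ z ]) (step (run L₀ h) z mv) z y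

  mode : ∀ m → HasMode L₀ (requests h) z y m →
         HasMode L₀ (requests h ++ [ z ]) z y (modeAfterRequestFirst m)
  mode = HasMode-requestFirst (complete z) (≺ᵢ⇒≢ u z≺ᵢy)

  stepTo-d : ∀ m w → w ≢ n' → State m w → State′ (modeAfterRequestFirst m) d
  stepTo-d m w w≢n' = Product.map (mode m) (flavor-d-after w w≢n')

  stepTo-doe : ∀ m w → State m w →
          let m′ = modeAfterRequestFirst m in State′ m′ d ⊎ (State′ m′ o ⊎ State′ m′ e)
  stepTo-doe m w (μ , φ) = Sum.map (mode m μ ,_) (Sum.map (mode m μ ,_) (mode m μ ,_)) (flavor-after w φ)
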